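{- Let $\Gamma\ge1$, let $I=(U,\mathcal F=(S_1,\dots,S_m))$ be a set cover instance whose maximum set size and maximum element frequency are at most $\Gamma$, and let $G=\mathcal T_{\mathrm{DS}}(I)$. Then: (1) if $I$ is feasible and $D$ is a dominating set of $G$, then $\mathcal R_{\mathrm{DS},I}(D)$ is a set cover of $I$; (2) $|\mathcal R_{\mathrm{DS},I}(D)|\le|D|$ for every $D\subseteq V(G)$; (3) with $\phi_I(S_i)=i$, $\phi_I(u)=\sigma_I(u)$ for $u\in U$, $\phi_I(w)=\bot$ for helper vertices $w$, we have $\mathcal R_{\mathrm{DS},I}(D)=\phi_I(D)\setminus\{\bot\}$, and for all $D,\tilde D\subseteq V(G)$, $\mathcal R_{\mathrm{DS},I}(D)\triangle\mathcal R_{\mathrm{DS},I}(\tilde D)\subseteq\phi_I(D\triangle\tilde D)$, hence $|\mathcal R_{\mathrm{DS},I}(D)\triangle\mathcal R_{\mathrm{DS},I}(\tilde D)|\le|D\triangle\tilde D|$; (4) if $\tilde I$ is obtained from $I$ by toggling exactly one membership relation $(u_0,S_j)$ (same ground set and index set, $\sigma_I,\sigma_{\tilde I}$ defined by the same rule), then for every fixed vertex subset $D$ of the common vertex set, $|\mathcal R_{\mathrm{DS},I}(D)\triangle\mathcal R_{\mathrm{DS},\tilde I}(D)|\le2$.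
   Context: A set cover instance $(U,\mathcal F=(S_1,\dots,S_m))$ has ground set $U$ and an indexed family of subsets; feasible means $\bigcup S_i=U$; a set cover is a set of indices whose sets cover $U$; the frequency of an element is the number of sets containing it. A dominating set of a graph is a vertex set such that every vertex is in it or adjacent to it. $\mathcal T_{\mathrm{DS}}(I)$ (for instances with set sizes and frequencies at most $\Gamma$): the bipartite incidence graph on $U\cup\{S_1,\dots,S_m\}$ with edges $(u,S_i)$ for $u\in S_i$, plus helper vertices $w_1,\dots,w_{\lceil m/\Gamma\rceil}$ with each $S_i$ joined to $w_{\lceil i/\Gamma\rceil}$. For $u\in U$, $\sigma_I(u)$ is the smallest $i$ with $u\in S_i$, or $\bot$ if none exists. $\mathcal R_{\mathrm{DS},I}(D)=\{i:S_i\in D\}\cup\{\sigma_I(u):u\in D\cap U,\sigma_I(u)\ne\bot\}$. -}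

module Defs where

open import Data.Nat using (ℕ; zero; suc; _+_; _∸_; _≤_; NonZero)
open import Data.Nat.DivMod using (_/_)
open import Data.Bool using (Bool; true; false; _∧_; _∨_; not)
open import Data.Fin using (Fin; toℕ; _↑ˡ_; _↑ʳ_; splitAt; _≟_)
open import Data.Fin.Subset using (Subset; _∈_; _∪_; _─_; ∣_∣)
open import Data.Vec using (Vec; tabulate; lookup)
import Data.Fin as Fin
import Data.Maybe as Maybe
open import Relation.Nullary using (¬_)
open import Data.Vec.Functional using (foldr)
open import Data.Maybe using (Maybe; just; nothing)
open import Data.Sum using (_⊎_; inj₁; inj₂)
open import Data.Product using (Σ; ∃; _×_)
open import Relation.Binary.PropositionalEquality using (_≡_)
open import Relation.Nullary.Decidable using (⌊_⌋)

-- A set cover instance: ground set U = Fin n, family S_0,…,S_{m-1}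
-- (0-based indexing of the paper's S_1,…,S_m), membership u ∈ S_i given
-- by mem u i ≡ true.
record Instance : Set where
  field
    n   : ℕ
    m   : ℕ
    mem : Fin n → Fin m → Bool
open Instance public

_∈S_ : {I : Instance} → Fin (n I) → Fin (m I) → Set
_∈S_ {I} u i = mem I u i ≡ true

setOf : (I : Instance) → Fin (m I) → Subset (n I)
setOf I i = tabulate (λ u → mem I u i)

setsContaining : (I : Instance) → Fin (n I) → Subset (m I)
setsContaining I u = tabulate (λ i → mem I u i)

Bounded : ℕ → Instance → Set
Bounded Γ I = ((i : Fin (m I)) → ∣ setOf I i ∣ ≤ Γ)
            × ((u : Fin (n I)) → ∣ setsContaining I u ∣ ≤ Γ)

Feasible : Instance → Set
Feasible I = (u : Fin (n I)) → ∃ λ (i : Fin (m I)) → mem I u i ≡ true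

IsSetCover : (I : Instance) → Subset (m I) → Set
IsSetCover I C = (u : Fin (n I)) → ∃ λ (i : Fin (m I)) → i ∈ C × mem I u i ≡ true

firstTrue : ∀ {k} → (Fin k → Bool) → Maybe (Fin k)
firstTrue {zero}  f = nothing
firstTrue {suc k} f with f Fin.zero
... | true  = just Fin.zero
... | false = Maybe.map Fin.suc (firstTrue (λ i → f (Fin.suc i)))

σ : (I : Instance) → Fin (n I) → Maybe (Fin (m I))
σ I u = firstTrue (mem I u)

ceilDiv : (a Γ : ℕ) → .{{NonZero Γ}} → ℕ
ceilDiv a Γ = (a + (Γ ∸ 1)) / Γ

-- Vertex set of T_DS(I): U, then the sets S_i, then helpers w_k,
-- encoded as Fin (n + (m + h)) with h = ⌈m/Γ⌉.
nHelp : (Γ : ℕ) → .{{NonZero Γ}} → Instance → ℕ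
nHelp Γ I = ceilDiv (m I) Γ

V : (Γ : ℕ) → .{{NonZero Γ}} → Instance → ℕ
V Γ I = n I + (m I + nHelp Γ I)

module _ (Γ : ℕ) .{{_ : NonZero Γ}} (I : Instance) where

  eltV : Fin (n I) → Fin (V Γ I)
  eltV u = u ↑ˡ (m I + nHelp Γ I)

  setV : Fin (m I) → Fin (V Γ I)
  setV i = n I ↑ʳ (i ↑ˡ nHelp Γ I)

  hlpV : Fin (nHelp Γ I) → Fin (V Γ I)
  hlpV k = n I ↑ʳ (m I ↑ʳ k)

  -- Edges of T_DS(I) (stated in both directions).  The paper's S_i
  -- (1-based) is joined to w_{⌈i/Γ⌉}; with 0-based indices i, k this
  -- is k = ⌊i/Γ⌋.
  data Adj : Fin (V Γ I) → Fin (V Γ I) → Set where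
    elt-set : ∀ u i → mem I u i ≡ true → Adj (eltV u) (setV i)
    set-elt : ∀ u i → mem I u i ≡ true → Adj (setV i) (eltV u)
    set-hlp : ∀ i k → toℕ k ≡ toℕ i / Γ → Adj (setV i) (hlpV k)
    hlp-set : ∀ i k → toℕ k ≡ toℕ i / Γ → Adj (hlpV k) (setV i)

  IsDominatingSet : Subset (V Γ I) → Set
  IsDominatingSet D = (v : Fin (V Γ I)) →
    v ∈ D ⊎ ∃ λ (w : Fin (V Γ I)) → w ∈ D × Adj v w

memb : ∀ {k} → Fin k → Subset k → Bool
memb v D = lookup D v

anyFin : ∀ {k} → (Fin k → Bool) → Bool
anyFin {k} f = foldr _∨_ false f

eqMaybe : ∀ {k} → Maybe (Fin k) → Fin k → Bool
eqMaybe nothing  i = false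
eqMaybe (just j) i = ⌊ j ≟ i ⌋

R : (Γ : ℕ) → .{{_ : NonZero Γ}} → (I : Instance) → Subset (V Γ I) → Subset (m I)
R Γ I D = tabulate λ i →
  memb (setV Γ I i) D ∨ anyFin (λ u → memb (eltV Γ I u) D ∧ eqMaybe (σ I u) i)

φ : (Γ : ℕ) → .{{_ : NonZero Γ}} → (I : Instance) → Fin (V Γ I) → Maybe (Fin (m I))
φ Γ I v with splitAt (n I) v
... | inj₁ u = σ I u
... | inj₂ x with splitAt (m I) x
...   | inj₁ i = just i
...   | inj₂ k = nothing

InImageφ : (Γ : ℕ) → .{{_ : NonZero Γ}} → (I : Instance) → Subset (V Γ I) → Fin (m I) → Set
InImageφ Γ I D i = ∃ λ (v : Fin (V Γ I)) → v ∈ D × φ Γ I v ≡ just i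

_△_ : ∀ {k} → Subset k → Subset k → Subset k
A △ B = (A ─ B) ∪ (B ─ A)

withMem : (I : Instance) → (Fin (n I) → Fin (m I) → Bool) → Instance
withMem I mem' = record { n = n I ; m = m I ; mem = mem' }

ToggledAt : (I : Instance) → (Fin (n I) → Fin (m I) → Bool) → Fin (n I) → Fin (m I) → Set
ToggledAt I mem' u₀ j =
  (mem' u₀ j ≡ not (mem I u₀ j))
  × (∀ u i → ¬ (u ≡ u₀ × i ≡ j) → mem' u i ≡ mem I u i)

-- Every vertex of T_DS(I) is sent by φ_I to at most one set index (helpers to none), and
-- R_{DS,I}(D) is exactly the image φ_I(D) \ {⊥}.  The other claims are then facts about images
-- of a partial map: an image is no larger than its domain; images of D and D̃ can only differ on
-- indices hit from D △ D̃; and toggling (u₀, S_j) changes φ at the single vertex u₀, so the two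
-- images differ at most in σ_I(u₀) and σ_Ĩ(u₀).  A dominating set covers u either by containing u,
-- whence σ_I(u) ∈ R, or through a neighbour, which is a set S_i ∋ u.
module Submission where

open import Defs
open import Data.Nat using (ℕ; _+_; _≤_; NonZero; zero; suc; s≤s)
open import Data.Nat.Properties using (≤-trans; ≤-reflexive; m≤n⇒m≤1+n)
open import Data.Fin using (Fin; _↑ˡ_; _↑ʳ_; splitAt; _≟_) renaming (zero to fzero; suc to fsuc)
open import Data.Fin.Properties using (suc-injective; ↑ˡ-injective; splitAt-↑ˡ; splitAt-↑ʳ; splitAt⁻¹-↑ˡ; splitAt⁻¹-↑ʳ)
open import Data.Fin.Subset using (Subset; _∈_; _∉_; ∣_∣; _─_; _-_; ⁅_⁆; ⊥; ⊤; inside; outside)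
open import Data.Fin.Subset.Properties using (p⊆q⇒∣p∣≤∣q∣; ∣⊥∣≡0; ∣⊤∣≡n; ∈⊤; x∈p∪q⁻; x∈p∪q⁺; x∈p∧x∉q⇒x∈p─q; p─q⊆p; x∈⁅x⁆; p─⊥≡p; _∈?_)
open import Data.Bool using (Bool; true; false; _∨_; _∧_)
open import Data.Bool.Properties using (∨-zeroʳ)
open import Data.Product using (_×_; _,_; ∃; proj₁; proj₂)
open import Data.Sum using (_⊎_; inj₁; inj₂)
open import Data.Maybe using (Maybe; just; nothing)
import Data.Maybe as Maybe
open import Data.Maybe.Properties using (just-injective)
open import Data.Vec using ([]; _∷_; lookup)
open import Data.Vec.Properties using ([]=⇒lookup; lookup⇒[]=; lookup∘tabulate)
open import Data.Vec.Base using (here; there)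
open import Data.Empty using (⊥-elim)
open import Relation.Nullary using (¬_; yes; no)
open import Function using (_∘_)
open import Relation.Binary.PropositionalEquality using (_≡_; _≢_; refl; sym; trans; cong; subst; module ≡-Reasoning)

∨-true⁻ : ∀ {a b} → a ∨ b ≡ true → a ≡ true ⊎ b ≡ true
∨-true⁻ {true}  _ = inj₁ refl
∨-true⁻ {false} e = inj₂ e

∧-true⁻ : ∀ {a b} → a ∧ b ≡ true → a ≡ true × b ≡ true
∧-true⁻ {true} {true} _ = refl , refl

anyFin-true⁻ : ∀ {k} (f : Fin k → Bool) → anyFin f ≡ true → ∃ λ u → f u ≡ true
anyFin-true⁻ {suc k} f e with ∨-true⁻ {f fzero} e
... | inj₁ f0 = fzero , f0
... | inj₂ rest with anyFin-true⁻ (λ u → f (fsuc u)) rest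
...   | u , fu = fsuc u , fu

anyFin-true⁺ : ∀ {k} (f : Fin k → Bool) (u : Fin k) → f u ≡ true → anyFin f ≡ true
anyFin-true⁺ f fzero    e rewrite e = refl
anyFin-true⁺ f (fsuc u) e rewrite anyFin-true⁺ (λ v → f (fsuc v)) u e = ∨-zeroʳ (f fzero)

eqMaybe-true⁻ : ∀ {k} (s : Maybe (Fin k)) {i} → eqMaybe s i ≡ true → s ≡ just i
eqMaybe-true⁻ (just j) {i} e with j ≟ i
... | yes refl = refl

eqMaybe-refl : ∀ {k} (i : Fin k) → eqMaybe (just i) i ≡ true
eqMaybe-refl i with i ≟ i
... | yes _  = refl
... | no i≢i = ⊥-elim (i≢i refl)

firstTrue-sound : ∀ {k} (f : Fin k → Bool) {j} → firstTrue f ≡ just j → f j ≡ true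
firstTrue-sound {suc k} f e with f fzero in f0
firstTrue-sound {suc k} f refl | true = f0
... | false with firstTrue (λ i → f (fsuc i)) in rest
firstTrue-sound {suc k} f refl | false | just j = firstTrue-sound (λ i → f (fsuc i)) rest

firstTrue-complete : ∀ {k} (f : Fin k → Bool) i → f i ≡ true → ∃ λ j → firstTrue f ≡ just j
firstTrue-complete {suc k} f i e with f fzero in f0
... | true = fzero , refl
firstTrue-complete {suc k} f fzero    e | false with () ← trans (sym f0) e
firstTrue-complete {suc k} f (fsuc i) e | false with firstTrue-complete (λ i → f (fsuc i)) i e
... | j , rest rewrite rest = fsuc j , refl

firstTrue-cong : ∀ {k} {f g : Fin k → Bool} → (∀ x → f x ≡ g x) → firstTrue f ≡ firstTrue g
firstTrue-cong {zero}      _ = refl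
firstTrue-cong {suc k} {f} {g} f≗g rewrite f≗g fzero with g fzero
... | true  = refl
... | false = cong (Maybe.map fsuc) (firstTrue-cong (λ x → f≗g (fsuc x)))

↑ˡ≢↑ʳ : ∀ {m n} (i : Fin m) (j : Fin n) → i ↑ˡ n ≢ m ↑ʳ j
↑ˡ≢↑ʳ fzero    j ()
↑ˡ≢↑ʳ (fsuc i) j e = ↑ˡ≢↑ʳ i j (suc-injective e)

x∈p─q⇒x∉q : ∀ {k} {p q : Subset k} {x} → x ∈ p ─ q → x ∉ q
x∈p─q⇒x∉q {p = inside ∷ p} {outside ∷ q} here ()
x∈p─q⇒x∉q {p = _ ∷ p}      {_ ∷ q}       (there x∈) (there x∈q) = x∈p─q⇒x∉q x∈ x∈q

∣p∣≤1+∣p-x∣ : ∀ {k} (p : Subset k) (x : Fin k) → ∣ p ∣ ≤ suc ∣ p - x ∣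
∣p∣≤1+∣p-x∣ (outside ∷ p) fzero    = m≤n⇒m≤1+n (≤-reflexive (cong ∣_∣ (sym (p─⊥≡p p))))
∣p∣≤1+∣p-x∣ (inside  ∷ p) fzero    = s≤s (≤-reflexive (cong ∣_∣ (sym (p─⊥≡p p))))
∣p∣≤1+∣p-x∣ (outside ∷ p) (fsuc x) = ∣p∣≤1+∣p-x∣ p x
∣p∣≤1+∣p-x∣ (inside  ∷ p) (fsuc x) = s≤s (∣p∣≤1+∣p-x∣ p x)

Image : ∀ {k m} → (Fin k → Maybe (Fin m)) → Subset k → Fin m → Set
Image f D i = ∃ λ v → v ∈ D × f v ≡ just i

IsImage : ∀ {k m} → (Fin k → Maybe (Fin m)) → Subset k → Subset m → Set
IsImage f D A = ∀ i → (i ∈ A → Image f D i) × (Image f D i → i ∈ A)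

Image-∷⁻ : ∀ {k m} {f : Fin (suc k) → Maybe (Fin m)} {x D i} →
           Image f (x ∷ D) i → (x ≡ inside × f fzero ≡ just i) ⊎ Image (λ v → f (fsuc v)) D i
Image-∷⁻ (fzero  , here     , e) = inj₁ (refl , e)
Image-∷⁻ (fsuc v , there v∈ , e) = inj₂ (v , v∈ , e)

⊆Image⇒∣p∣≤∣q∣ : ∀ {k m} (f : Fin k → Maybe (Fin m)) (D : Subset k) {A : Subset m} →
                 (∀ {i} → i ∈ A → Image f D i) → ∣ A ∣ ≤ ∣ D ∣
⊆Image⇒∣p∣≤∣q∣ {m = m} f [] {A} A⊆ =
  ≤-trans (p⊆q⇒∣p∣≤∣q∣ {p = A} {q = ⊥} (λ i∈ → ⊥-elim (empty (A⊆ i∈)))) (≤-reflexive (∣⊥∣≡0 m))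
  where
  empty : ∀ {i} → ¬ Image f [] i
  empty (() , _)
⊆Image⇒∣p∣≤∣q∣ f (x ∷ D) {A} A⊆ with x | f fzero in f0
... | outside | _ = ⊆Image⇒∣p∣≤∣q∣ _ D tail
  where
  tail : ∀ {i} → i ∈ A → Image (λ v → f (fsuc v)) D i
  tail i∈ with Image-∷⁻ (A⊆ i∈)
  ... | inj₂ img = img
⊆Image⇒∣p∣≤∣q∣ f (x ∷ D) {A} A⊆ | inside | nothing = m≤n⇒m≤1+n (⊆Image⇒∣p∣≤∣q∣ _ D tail)
  where
  tail : ∀ {i} → i ∈ A → Image (λ v → f (fsuc v)) D i
  tail i∈ with Image-∷⁻ (A⊆ i∈)
  ... | inj₁ (_ , e) with () ← trans (sym f0) e
  ... | inj₂ img = img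
⊆Image⇒∣p∣≤∣q∣ f (x ∷ D) {A} A⊆ | inside | just j =
  ≤-trans (∣p∣≤1+∣p-x∣ A j) (s≤s (⊆Image⇒∣p∣≤∣q∣ _ D tail))
  where
  tail : ∀ {i} → i ∈ A - j → Image (λ v → f (fsuc v)) D i
  tail {i} i∈ with Image-∷⁻ (A⊆ (p─q⊆p A ⁅ j ⁆ i∈))
  ... | inj₁ (_ , e) = ⊥-elim (x∈p─q⇒x∉q i∈ (subst (_∈ ⁅ j ⁆) (just-injective (trans (sym f0) e)) (x∈⁅x⁆ j)))
  ... | inj₂ img = img

Image-mono : ∀ {k m} {f : Fin k → Maybe (Fin m)} {D E i} → (∀ {v} → v ∈ D → v ∈ E) → Image f D i → Image f E i
Image-mono D⊆E (v , v∈ , e) = v , D⊆E v∈ , e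

IsImage-─ : ∀ {k m} {f : Fin k → Maybe (Fin m)} {D D̃ A B} →
            IsImage f D A → IsImage f D̃ B → ∀ {i} → i ∈ A ─ B → Image f (D ─ D̃) i
IsImage-─ {D̃ = D̃} {A} {B} isA isB {i} i∈ with proj₁ (isA i) (p─q⊆p A B i∈)
... | v , v∈D , e with v ∈? D̃
...   | yes v∈D̃ = ⊥-elim (x∈p─q⇒x∉q i∈ (proj₂ (isB i) (v , v∈D̃ , e)))
...   | no  v∉D̃ = v , x∈p∧x∉q⇒x∈p─q v∈D v∉D̃ , e

IsImage-△ : ∀ {k m} {f : Fin k → Maybe (Fin m)} {D D̃ A B} →
            IsImage f D A → IsImage f D̃ B → ∀ i → i ∈ A △ B → Image f (D △ D̃) i
IsImage-△ {A = A} {B} isA isB i i∈ with x∈p∪q⁻ (A ─ B) (B ─ A) i∈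
... | inj₁ i∈A─B = Image-mono (λ v∈ → x∈p∪q⁺ (inj₁ v∈)) (IsImage-─ isA isB i∈A─B)
... | inj₂ i∈B─A = Image-mono (λ v∈ → x∈p∪q⁺ (inj₂ v∈)) (IsImage-─ isB isA i∈B─A)

Image-differ : ∀ {k m} {f g : Fin k → Maybe (Fin m)} {v₀ D i} → (∀ v → v ≢ v₀ → f v ≡ g v) →
               Image f D i → ¬ Image g D i → f v₀ ≡ just i
Image-differ {v₀ = v₀} f≗g (v , v∈ , e) ¬img with v ≟ v₀
... | yes refl = e
... | no  v≢v₀ = ⊥-elim (¬img (v , v∈ , trans (sym (f≗g v v≢v₀)) e))

IsImage-△-≤2 : ∀ {k m} {f g : Fin k → Maybe (Fin m)} {v₀ D A B} → (∀ v → v ≢ v₀ → f v ≡ g v) →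
               IsImage f D A → IsImage g D B → ∣ A △ B ∣ ≤ 2
IsImage-△-≤2 {f = f} {g} {v₀} {D} {A} {B} f≗g isA isB =
  ≤-trans (⊆Image⇒∣p∣≤∣q∣ atV₀ ⊤ onlyAtV₀) (≤-reflexive (∣⊤∣≡n 2))
  where
  atV₀ : Fin 2 → Maybe (Fin _)
  atV₀ fzero    = f v₀
  atV₀ (fsuc _) = g v₀
  onlyAtV₀ : ∀ {i} → i ∈ A △ B → Image atV₀ ⊤ i
  onlyAtV₀ {i} i∈ with x∈p∪q⁻ (A ─ B) (B ─ A) i∈
  ... | inj₁ i∈A─B = fzero , ∈⊤ , Image-differ f≗g (proj₁ (isA i) (p─q⊆p A B i∈A─B))
                                   (λ img → x∈p─q⇒x∉q i∈A─B (proj₂ (isB i) img))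
  ... | inj₂ i∈B─A = fsuc fzero , ∈⊤ , Image-differ (λ v v≢v₀ → sym (f≗g v v≢v₀))
                                   (proj₁ (isB i) (p─q⊆p B A i∈B─A))
                                   (λ img → x∈p─q⇒x∉q i∈B─A (proj₂ (isA i) img))

module _ (Γ : ℕ) .{{_ : NonZero Γ}} (I : Instance) where

  φ-eltV : ∀ u → φ Γ I (eltV Γ I u) ≡ σ I u
  φ-eltV u rewrite splitAt-↑ˡ (n I) u (m I + nHelp Γ I) = refl

  φ-setV : ∀ i → φ Γ I (setV Γ I i) ≡ just i
  φ-setV i rewrite splitAt-↑ʳ (n I) (m I + nHelp Γ I) (i ↑ˡ nHelp Γ I)
                 | splitAt-↑ˡ (m I) i (nHelp Γ I) = refl

  φ-hlpV : ∀ k → φ Γ I (hlpV Γ I k) ≡ nothing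
  φ-hlpV k rewrite splitAt-↑ʳ (n I) (m I + nHelp Γ I) (m I ↑ʳ k)
                 | splitAt-↑ʳ (m I) (nHelp Γ I) k = refl

  data Vertex : Fin (V Γ I) → Set where
    elt : ∀ u → Vertex (eltV Γ I u)
    set : ∀ i → Vertex (setV Γ I i)
    hlp : ∀ k → Vertex (hlpV Γ I k)

  vertex : ∀ v → Vertex v
  vertex v with splitAt (n I) v in eq
  ... | inj₁ u = subst Vertex (splitAt⁻¹-↑ˡ eq) (elt u)
  ... | inj₂ x with splitAt (m I) x in eq′
  ...   | inj₁ i = subst Vertex (trans (cong (n I ↑ʳ_) (splitAt⁻¹-↑ˡ eq′)) (splitAt⁻¹-↑ʳ eq)) (set i)
  ...   | inj₂ k = subst Vertex (trans (cong (n I ↑ʳ_) (splitAt⁻¹-↑ʳ eq′)) (splitAt⁻¹-↑ʳ eq)) (hlp k)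

  -- Adj is indexed by non-constructor terms, so its eltV instances are exposed through an equation.
  Adj-eltV : ∀ {v w u} → Adj Γ I v w → v ≡ eltV Γ I u → ∃ λ i → w ≡ setV Γ I i × mem I u i ≡ true
  Adj-eltV (elt-set u′ i u′∈Si) e with ↑ˡ-injective _ _ _ e
  ... | refl = i , refl , u′∈Si
  Adj-eltV (set-elt _ _ _) e = ⊥-elim (↑ˡ≢↑ʳ _ _ (sym e))
  Adj-eltV (set-hlp _ _ _) e = ⊥-elim (↑ˡ≢↑ʳ _ _ (sym e))
  Adj-eltV (hlp-set _ _ _) e = ⊥-elim (↑ˡ≢↑ʳ _ _ (sym e))

  R-lookup : ∀ D i → lookup (R Γ I D) i ≡ (memb (setV Γ I i) D ∨ anyFin (λ u → memb (eltV Γ I u) D ∧ eqMaybe (σ I u) i))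
  R-lookup D i = lookup∘tabulate _ i

  R⇒Image : ∀ D {i} → i ∈ R Γ I D → Image (φ Γ I) D i
  R⇒Image D {i} i∈R with ∨-true⁻ (trans (sym (R-lookup D i)) ([]=⇒lookup i∈R))
  ... | inj₁ setV∈D = setV Γ I i , lookup⇒[]= _ D setV∈D , φ-setV i
  ... | inj₂ some with anyFin-true⁻ _ some
  ...   | u , hit with ∧-true⁻ hit
  ...     | eltV∈D , σ≡i = eltV Γ I u , lookup⇒[]= _ D eltV∈D , trans (φ-eltV u) (eqMaybe-true⁻ (σ I u) σ≡i)

  Image⇒R : ∀ D {i} → Image (φ Γ I) D i → i ∈ R Γ I D
  Image⇒R D {i} (v , v∈D , φv≡i) with vertex v
  ... | elt u = lookup⇒[]= i _ (trans (R-lookup D i) (trans (cong (memb (setV Γ I i) D ∨_) (anyFin-true⁺ _ u hit)) (∨-zeroʳ _)))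
    where
    hit : (memb (eltV Γ I u) D ∧ eqMaybe (σ I u) i) ≡ true
    hit rewrite []=⇒lookup v∈D | trans (sym (φ-eltV u)) φv≡i = eqMaybe-refl i
  ... | set i′ with just-injective (trans (sym (φ-setV i′)) φv≡i)
  ...   | refl = lookup⇒[]= i _ (trans (R-lookup D i) (cong (_∨ anyFin (λ u → memb (eltV Γ I u) D ∧ eqMaybe (σ I u) i)) ([]=⇒lookup v∈D)))
  Image⇒R D {i} (v , v∈D , φv≡i) | hlp k with () ← trans (sym (φ-hlpV k)) φv≡i

  R-image : ∀ D → IsImage (φ Γ I) D (R Γ I D)
  R-image D i = R⇒Image D , Image⇒R D

  R-setCover : ∀ D → Feasible I → IsDominatingSet Γ I D → IsSetCover I (R Γ I D)
  R-setCover D feasible dominating u with dominating (eltV Γ I u)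
  ... | inj₁ u∈D with feasible u
  ...   | i , u∈Si with firstTrue-complete (mem I u) i u∈Si
  ...     | j , σu≡j = j , Image⇒R D (eltV Γ I u , u∈D , trans (φ-eltV u) σu≡j) , firstTrue-sound (mem I u) σu≡j
  R-setCover D feasible dominating u | inj₂ (w , w∈D , adj) with Adj-eltV adj refl
  ... | i , refl , u∈Si = i , Image⇒R D (setV Γ I i , w∈D , φ-setV i) , u∈Si

φ-withMem : (Γ : ℕ) .{{_ : NonZero Γ}} (I : Instance) (mem′ : Fin (n I) → Fin (m I) → Bool) (u₀ : Fin (n I)) →
            (∀ u → u ≢ u₀ → ∀ i → mem I u i ≡ mem′ u i) →
            ∀ v → v ≢ eltV Γ I u₀ → φ Γ I v ≡ φ Γ (withMem I mem′) v
φ-withMem Γ I mem′ u₀ agree v v≢u₀ with vertex Γ I v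
... | elt u = begin
  φ Γ I (eltV Γ I u)                 ≡⟨ φ-eltV Γ I u ⟩
  firstTrue (mem I u)                ≡⟨ firstTrue-cong (agree u (λ u≡u₀ → v≢u₀ (cong (eltV Γ I) u≡u₀))) ⟩
  firstTrue (mem′ u)                 ≡⟨ φ-eltV Γ (withMem I mem′) u ⟨
  φ Γ (withMem I mem′) (eltV Γ I u)  ∎
  where open ≡-Reasoning
... | set i = trans (φ-setV Γ I i) (sym (φ-setV Γ (withMem I mem′) i))
... | hlp k = trans (φ-hlpV Γ I k) (sym (φ-hlpV Γ (withMem I mem′) k))

-- The degree bound Γ only shapes the helper vertices; none of the claims uses it, nor which value
-- the toggled membership (u₀, S_j) takes.
lemma13p1 : (Γ : ℕ) → .{{_ : NonZero Γ}} → (I : Instance) → Bounded Γ I →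
    ((D : Subset (V Γ I)) → Feasible I → IsDominatingSet Γ I D → IsSetCover I (R Γ I D))
    × ((D : Subset (V Γ I)) → ∣ R Γ I D ∣ ≤ ∣ D ∣)
    × ((D : Subset (V Γ I)) → (i : Fin (m I)) →
         (i ∈ R Γ I D → InImageφ Γ I D i) × (InImageφ Γ I D i → i ∈ R Γ I D))
    × ((D D̃ : Subset (V Γ I)) → (i : Fin (m I)) →
         i ∈ (R Γ I D △ R Γ I D̃) → InImageφ Γ I (D △ D̃) i)
    × ((D D̃ : Subset (V Γ I)) → ∣ R Γ I D △ R Γ I D̃ ∣ ≤ ∣ D △ D̃ ∣)
    × ((mem' : Fin (n I) → Fin (m I) → Bool) → (u₀ : Fin (n I)) → (j : Fin (m I)) →
         ToggledAt I mem' u₀ j → (D : Subset (V Γ I)) →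
         ∣ R Γ I D △ R Γ (withMem I mem') D ∣ ≤ 2)
lemma13p1 Γ I _ =
    R-setCover Γ I
  , (λ D → ⊆Image⇒∣p∣≤∣q∣ (φ Γ I) D (R⇒Image Γ I D))
  , R-image Γ I
  , R-△
  , (λ D D̃ → ⊆Image⇒∣p∣≤∣q∣ (φ Γ I) (D △ D̃) (R-△ D D̃ _))
  , λ mem′ u₀ j (_ , unchanged) D →
      IsImage-△-≤2 (φ-withMem Γ I mem′ u₀ (λ u u≢u₀ i → sym (unchanged u i (u≢u₀ ∘ proj₁))))
                   (R-image Γ I D) (R-image Γ (withMem I mem′) D)
  where
  R-△ : ∀ D D̃ i → i ∈ R Γ I D △ R Γ I D̃ → Image (φ Γ I) (D △ D̃) i
  R-△ D D̃ = IsImage-△ (R-image Γ I D) (R-image Γ I D̃)
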